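{- The superadditivity principle for inability, $(\mathrm{Iab}_C\varphi\wedge\mathrm{Iab}_D\psi)\rightarrow\mathrm{Iab}_{C\cup D}(\varphi\wedge\psi)$, is not valid in general, even when $C\cap D=\emptyset$: there exist a finite non-empty set of agents $N$, disjoint coalitions $C,D\subseteq N$, formulas $\varphi,\psi$, a coalition model $\mathcal{M}$ over $N$ and a state $s$ with $\mathcal{M},s\models\mathrm{Iab}_C\varphi\wedge\mathrm{Iab}_D\psi$ and $\mathcal{M},s\not\models\mathrm{Iab}_{C\cup D}(\varphi\wedge\psi)$.
   Context: A coalition is any $C\subseteq N$, $\overline{C}=N\setminus C$. Formulas: $\varphi ::= p \mid \neg\varphi \mid (\varphi\wedge\psi) \mid [C]\varphi \mid \mathrm{Iab}_C\varphi$ over a countable set $\mathrm{Prop}$ of variables. A coalition model is $\mathcal{M}=(S,\{Act_i\}_{i\in N},o,V)$ with $S$ non-empty, each $Act_i$ non-empty, $o:S\times\prod_{i\in N}Act_i\to S$, $V:\mathrm{Prop}\to 2^S$; $Act_C=\prod_{i\in C}Act_i$ ($Act_\emptyset$ contains only the empty profile). $\mathcal{M},s\models[C]\varphi$ iff there is $\sigma_C\in Act_C$ such that for all $\sigma_{\overline{C}}\in Act_{\overline{C}}$, $\mathcal{M},o(s,\sigma_C,\sigma_{\overline{C}})\models\varphi$; $\mathcal{M},s\models\mathrm{Iab}_C\varphi$ iff $\mathcal{M},s\not\models[C]\varphi$; atoms and Boolean connectives as usual. -}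

module Defs where

open import Data.Nat using (ℕ; suc)
open import Data.Fin using (Fin)
open import Data.Fin.Subset using (Subset; _∈_; _∉_; _∪_)
open import Data.Fin.Subset.Properties using (_∈?_)
open import Data.Product using (Σ; ∃; _×_)
open import Relation.Nullary using (¬_; yes; no)

Prop : Set
Prop = ℕ

data Formula (n : ℕ) : Set where
  var  : Prop → Formula n
  ¬'_  : Formula n → Formula n
  _∧'_ : Formula n → Formula n → Formula n
  [_]_ : Subset n → Formula n → Formula n
  Iab  : Subset n → Formula n → Formula n

record CoalitionModel (n : ℕ) : Set₁ where
  field
    S      : Set
    S-ne   : S
    Act    : Fin n → Set
    Act-ne : (i : Fin n) → Act i
    o      : S → ((i : Fin n) → Act i) → S
    V      : Prop → S → Set

module _ {n : ℕ} (M : CoalitionModel n) where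
  open CoalitionModel M

  ActC : Subset n → Set
  ActC C = (i : Fin n) → i ∈ C → Act i

  ActCo : Subset n → Set
  ActCo C = (i : Fin n) → i ∉ C → Act i

  combine : (C : Subset n) → ActC C → ActCo C → (i : Fin n) → Act i
  combine C σ τ i with i ∈? C
  ... | yes p = σ i p
  ... | no ¬p = τ i ¬p

  Sat : S → Formula n → Set
  Sat s (var p)     = V p s
  Sat s (¬' φ)      = ¬ Sat s φ
  Sat s (φ ∧' ψ)    = Sat s φ × Sat s ψ
  Sat s ([ C ] φ)   = Σ (ActC C) λ σ → (τ : ActCo C) → Sat (o s (combine C σ τ)) φ
  Sat s (Iab C φ)   = ¬ (Σ (ActC C) λ σ → (τ : ActCo C) → Sat (o s (combine C σ τ)) φ)

-- Let every agent choose a bit, let the outcome of a joint action be the chosen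
-- profile itself, and let p_k say that agent k chose true. For distinct agents i
-- and j, the coalition {i} cannot force p_j (agent j answers false), and
-- symmetrically {j} cannot force p_i, yet {i, j} forces p_j ∧ p_i by having both
-- choose true.
module Submission where

open import Defs
open import Data.Bool using (Bool; true; false; T)
open import Data.Fin as Fin using (Fin; zero; toℕ)
open import Data.Fin.Properties using (toℕ-injective)
open import Data.Fin.Subset using (Subset; _∩_; _∪_; ⊥; ⁅_⁆; _∈_; _∉_)
open import Data.Fin.Subset.Properties
  using (_∈?_; x∈⁅x⁆; x≢y⇒x∉⁅y⁆; x∈p∪q⁺)
open import Data.Nat using (ℕ; suc)
open import Data.Product using (Σ; _×_; _,_)
open import Data.Sum using (inj₁; inj₂)
open import Relation.Binary.PropositionalEquality using (_≡_; _≢_; refl; sym; subst)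
open import Relation.Nullary using (¬_; yes; no; contradiction)

module _ {n : ℕ} (M : CoalitionModel n) where
  open CoalitionModel M

  combine-const-∈ : ∀ {C i} (f : (j : Fin n) → Act j) (τ : ActCo M C) →
                    i ∈ C → combine M C (λ j _ → f j) τ i ≡ f i
  combine-const-∈ {C} {i} f τ i∈C with i ∈? C
  ... | yes _   = refl
  ... | no  i∉C = contradiction i∈C i∉C

  combine-const-∉ : ∀ {C i} (σ : ActC M C) (f : (j : Fin n) → Act j) →
                    i ∉ C → combine M C σ (λ j _ → f j) i ≡ f i
  combine-const-∉ {C} {i} σ f i∉C with i ∈? C
  ... | yes i∈C = contradiction i∈C i∉C
  ... | no  _   = refl

bitGame : (n : ℕ) → CoalitionModel n
bitGame n = record
  { S      = Fin n → Bool
  ; S-ne   = λ _ → true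
  ; Act    = λ _ → Bool
  ; Act-ne = λ _ → true
  ; o      = λ _ σ → σ
  ; V      = λ p s → Σ (Fin n) λ i → toℕ i ≡ p × T (s i)
  }

plays : ∀ {n} → Fin n → Formula n
plays i = var (toℕ i)

module _ {n : ℕ} where
  open CoalitionModel (bitGame n) using (S)

  plays-intro : ∀ {s : S} {i} → T (s i) → Sat (bitGame n) s (plays i)
  plays-intro {i = i} sᵢ = i , refl , sᵢ

  plays-elim : ∀ {s : S} {i} → Sat (bitGame n) s (plays i) → T (s i)
  plays-elim {s} (k , k≡i , sₖ) = subst (λ k → T (s k)) (toℕ-injective k≡i) sₖ

  outsider-unforceable : ∀ (s : S) {C i} → i ∉ C → Sat (bitGame n) s (Iab C (plays i))
  outsider-unforceable _ i∉C (σ , forces) =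
    subst T (combine-const-∉ (bitGame n) σ (λ _ → false) i∉C)
          (plays-elim (forces (λ _ _ → false)))

  members-force-both : ∀ (s : S) {C i j} → i ∈ C → j ∈ C →
                       Sat (bitGame n) s ([ C ] (plays i ∧' plays j))
  members-force-both _ {C} i∈C j∈C = allTrue , λ τ →
      plays-intro (chooses-true τ i∈C) , plays-intro (chooses-true τ j∈C)
    where
      allTrue : ActC (bitGame n) C
      allTrue _ _ = true

      chooses-true : ∀ τ {k} → k ∈ C → T (combine (bitGame n) C allTrue τ k)
      chooses-true τ k∈C =
        subst T (sym (combine-const-∈ (bitGame n) (λ _ → true) τ k∈C)) _

  superadditivity-fails : ∀ (s : S) {i j} → i ≢ j →
    Sat (bitGame n) s (Iab ⁅ i ⁆ (plays j) ∧' Iab ⁅ j ⁆ (plays i)) ×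
    ¬ Sat (bitGame n) s (Iab (⁅ i ⁆ ∪ ⁅ j ⁆) (plays j ∧' plays i))
  superadditivity-fails s {i} {j} i≢j =
    ( outsider-unforceable s (x≢y⇒x∉⁅y⁆ (λ j≡i → i≢j (sym j≡i)))
    , outsider-unforceable s (x≢y⇒x∉⁅y⁆ i≢j) )
    , λ unable → unable
        (members-force-both s (x∈p∪q⁺ (inj₂ (x∈⁅x⁆ j))) (x∈p∪q⁺ (inj₁ (x∈⁅x⁆ i))))

theorem4p17 : Σ ℕ λ m → Σ (Subset (suc m)) λ C → Σ (Subset (suc m)) λ D →
    (C ∩ D ≡ ⊥) × Σ (Formula (suc m)) λ φ → Σ (Formula (suc m)) λ ψ →
    Σ (CoalitionModel (suc m)) λ M → Σ (CoalitionModel.S M) λ s →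
    Sat M s (Iab C φ ∧' Iab D ψ) × ¬ (Sat M s (Iab (C ∪ D) (φ ∧' ψ)))
theorem4p17 =
  1 , ⁅ zero ⁆ , ⁅ Fin.suc zero ⁆ , refl , plays (Fin.suc zero) , plays zero ,
  bitGame 2 , s , superadditivity-fails s λ ()
  where
    s : Fin 2 → Bool
    s _ = true
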